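{- If $\Gamma\vdash M:A$ is derivable in ${\cal S}^{\rightarrow\wedge\vee}$, then $\Gamma^{\circ}\vdash M^{\circ}:A^{\circ}$ is derivable in ${\cal S}^{\mu}$, where $\Gamma^{\circ}$ is obtained from $\Gamma$ by replacing all types by their translations and adding the declaration $\varphi:\neg\bot$.
   Context: Variables: disjoint infinite sets ${\cal V}$ (term variables) and ${\cal W}$ ($\mu$-variables), with a special $\mu$-variable $\varphi\in{\cal W}$. $\lambda\mu^{\rightarrow\wedge\vee}$-terms: $M ::= x \mid \lambda x.M \mid (M\;\varepsilon) \mid \langle M,M\rangle \mid \omega_1 M \mid \omega_2 M \mid \mu\alpha.M \mid (\alpha\; M)$, $\varepsilon ::= M \mid \pi_1 \mid \pi_2 \mid [x_1.M, x_2.M]$. $\lambda\mu$-terms: $M ::= x \mid \lambda x.M\mid (M\;M)\mid\mu\alpha.M\mid(\alpha\;M)$. Types: $A ::= X\mid\bot\mid A\rightarrow A\mid A\wedge A\mid A\vee A$ ($X$ atomic constants), $\neg A:=A\rightarrow\bot$. Type translation: $A^{\circ}=A$ for atomic $A$ and $\bot$; $(A_1\rightarrow A_2)^{\circ}=A_1^{\circ}\rightarrow A_2^{\circ}$; $(A_1\wedge A_2)^{\circ}=\neg(A_1^{\circ}\rightarrow(A_2^{\circ}\rightarrow\bot))$; $(A_1\vee A_2)^{\circ}=\neg A_1^{\circ}\rightarrow(\neg A_2^{\circ}\rightarrow\bot)$. Term translation into $\lambda\mu$-terms: $x^{\circ}=x$; $(\lambda x.M)^{\circ}=\lambda x.M^{\circ}$;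 $(M\;N)^{\circ}=(M^{\circ}\;N^{\circ})$; $(\mu\alpha.M)^{\circ}=\mu\alpha.M^{\circ}$; $(\alpha\;M)^{\circ}=(\alpha\;M^{\circ})$; $\langle M,N\rangle^{\circ}=\lambda x.(x\;M^{\circ}\;N^{\circ})$; $(M\;\pi_i)^{\circ}=\mu\alpha.(\varphi\;(M^{\circ}\;\lambda x_1.\lambda x_2.\mu\gamma.(\alpha\;x_i)))$; $(M\;[x_1.N_1,x_2.N_2])^{\circ}=\mu\alpha.(\varphi\;(M^{\circ}\;\lambda x_1.\mu\gamma.(\alpha\;N_1^{\circ})\;\lambda x_2.\mu\gamma.(\alpha\;N_2^{\circ})))$; $(\omega_iM)^{\circ}=\lambda x_1.\lambda x_2.(x_i\;M^{\circ})$ (with $\alpha,\gamma,x$ fresh; application associates to the left). Contexts: declarations $x:A$, $\alpha:\neg B$, each variable at most once. ${\cal S}^{\mu}$ (on $\lambda\mu$-terms, types without $\wedge,\vee$) has rules: $\Gamma,x:A\vdash x:A$; $\Gamma,x:A\vdash M:B\Rightarrow\Gamma\vdash\lambda x.M:A\rightarrow B$; $\Gamma\vdash M:A\rightarrow B$, $\Gamma\vdash N:A\Rightarrow\Gamma\vdash(M\;N):B$; $\Gamma,\alpha:\neg A\vdash M:A\Rightarrow\Gamma,\alpha:\neg A\vdash(\alpha\;M):\bot$; $\Gamma,\alpha:\neg A\vdash M:\bot\Rightarrow\Gamma\vdash\mu\alpha.M:A$. ${\cal S}^{\rightarrow\wedge\vee}$ (on $\lambda\mu^{\rightarrow\wedge\vee}$-terms)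 has these rules plus: $\Gamma\vdash M:A_1$, $\Gamma\vdash N:A_2\Rightarrow\Gamma\vdash\langle M,N\rangle:A_1\wedge A_2$; $\Gamma\vdash M:A_1\wedge A_2\Rightarrow\Gamma\vdash(M\;\pi_i):A_i$; $\Gamma\vdash M:A_j\Rightarrow\Gamma\vdash\omega_jM:A_1\vee A_2$; $\Gamma\vdash M:A_1\vee A_2$, $\Gamma,x_1:A_1\vdash N_1:C$, $\Gamma,x_2:A_2\vdash N_2:C\Rightarrow\Gamma\vdash(M\;[x_1.N_1,x_2.N_2]):C$. -}

module Defs where

open import Data.Nat using (ℕ; zero; suc; _⊔_)
open import Data.Fin using (Fin)
open import Relation.Binary.PropositionalEquality using (_≡_; _≢_)
open import Data.Unit using (⊤)
open import Data.Product using (_×_)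

-- Term variables 𝒱 and μ-variables 𝒲 are two disjoint
-- countably infinite sets, both represented by ℕ (disjointness is
-- enforced by the syntax: they live in different syntactic positions).

TVar : Set
TVar = ℕ

MVar : Set
MVar = ℕ

φ : MVar
φ = 0

data Ty : Set where
  atom : ℕ → Ty
  ⊥'   : Ty
  _⇒_  : Ty → Ty → Ty
  _∧'_ : Ty → Ty → Ty
  _∨'_ : Ty → Ty → Ty

infixr 7 _⇒_

data Tyμ : Set where
  atom : ℕ → Tyμ
  ⊥'   : Tyμ
  _⇒_  : Tyμ → Tyμ → Tyμ

¬μ : Tyμ → Tyμ
¬μ A = A ⇒ ⊥'

_° : Ty → Tyμ
atom X ° = atom X
⊥' ° = ⊥'
(A ⇒ B) ° = A ° ⇒ B °
(A ∧' B) ° = ¬μ (A ° ⇒ (B ° ⇒ ⊥'))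
(A ∨' B) ° = ¬μ (A °) ⇒ (¬μ (B °) ⇒ ⊥')

data Term : Set
data Elim : Set

data Term where
  var   : TVar → Term
  lam   : TVar → Term → Term
  app   : Term → Elim → Term
  pair  : Term → Term → Term
  inj   : Fin 2 → Term → Term              -- ω₁ M , ω₂ M  (index 0 ↦ 1, 1 ↦ 2)
  mu    : MVar → Term → Term
  named : MVar → Term → Term

data Elim where
  arg  : Term → Elim
  proj : Fin 2 → Elim
  case : TVar → Term → TVar → Term → Elim

data LTerm : Set where
  var   : TVar → LTerm
  lam   : TVar → LTerm → LTerm
  app   : LTerm → LTerm → LTerm
  mu    : MVar → LTerm → LTerm
  named : MVar → LTerm → LTerm

maxV : Term → ℕ
maxVε : Elim → ℕ
maxV (var x) = x
maxV (lam x M) = x ⊔ maxV M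
maxV (app M ε) = maxV M ⊔ maxVε ε
maxV (pair M N) = maxV M ⊔ maxV N
maxV (inj i M) = maxV M
maxV (mu α M) = maxV M
maxV (named α M) = maxV M
maxVε (arg N) = maxV N
maxVε (proj i) = 0
maxVε (case x₁ N₁ x₂ N₂) = x₁ ⊔ maxV N₁ ⊔ x₂ ⊔ maxV N₂

maxW : Term → ℕ
maxWε : Elim → ℕ
maxW (var x) = 0
maxW (lam x M) = maxW M
maxW (app M ε) = maxW M ⊔ maxWε ε
maxW (pair M N) = maxW M ⊔ maxW N
maxW (inj i M) = maxW M
maxW (mu α M) = α ⊔ maxW M
maxW (named α M) = α ⊔ maxW M
maxWε (arg N) = maxW N
maxWε (proj i) = 0
maxWε (case x₁ N₁ x₂ N₂) = maxW N₁ ⊔ maxW N₂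

-- Fresh variables at a node M are
--   term variables  x = x₁ = suc (maxV M),  x₂ = suc (suc (maxV M)),
--   μ-variables     α = suc (maxW M),       γ = suc (suc (maxW M)),
-- which are distinct from each other, from every variable of M and
-- (α, γ) from φ = 0.

pick : Fin 2 → TVar → TVar → TVar
pick Fin.zero a b = a
pick (Fin.suc _) a b = b

tr : Term → LTerm
tr (var x) = var x
tr (lam x M) = lam x (tr M)
tr (app M (arg N)) = app (tr M) (tr N)
tr t@(app M (proj i)) =
  let x₁ = suc (maxV t) ; x₂ = suc x₁ ; α = suc (maxW t) ; γ = suc α in
  mu α (named φ (app (tr M) (lam x₁ (lam x₂ (mu γ (named α (var (pick i x₁ x₂))))))))
tr t@(app M (case x₁ N₁ x₂ N₂)) =
  let α = suc (maxW t) ; γ = suc α in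
  mu α (named φ (app (app (tr M) (lam x₁ (mu γ (named α (tr N₁)))))
                                 (lam x₂ (mu γ (named α (tr N₂))))))
tr t@(pair M N) =
  let x = suc (maxV t) in
  lam x (app (app (var x) (tr M)) (tr N))
tr t@(inj i M) =
  let x₁ = suc (maxV t) ; x₂ = suc x₁ in
  lam x₁ (lam x₂ (app (var (pick i x₁ x₂)) (tr M)))
tr (mu α M) = mu α (tr M)
tr (named α M) = named α (tr M)

-- Contexts (over a type language T): declarations x : A and α : ¬B.
-- Declarations are added on the right; a later declaration of the same
-- variable shadows an earlier one.

data Ctx (T : Set) : Set where
  ∅    : Ctx T
  _,ᵗ_∶_ : Ctx T → TVar → T → Ctx T
  _,ᵐ_∶¬_ : Ctx T → MVar → T → Ctx T

infixl 5 _,ᵗ_∶_ _,ᵐ_∶¬_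

data _∋ᵗ_∶_ {T : Set} : Ctx T → TVar → T → Set where
  here  : ∀ {Γ x A} → (Γ ,ᵗ x ∶ A) ∋ᵗ x ∶ A
  thereᵗ : ∀ {Γ x y A B} → x ≢ y → Γ ∋ᵗ x ∶ A → (Γ ,ᵗ y ∶ B) ∋ᵗ x ∶ A
  thereᵐ : ∀ {Γ x β A B} → Γ ∋ᵗ x ∶ A → (Γ ,ᵐ β ∶¬ B) ∋ᵗ x ∶ A

data _∋ᵐ_∶¬_ {T : Set} : Ctx T → MVar → T → Set where
  here  : ∀ {Γ α B} → (Γ ,ᵐ α ∶¬ B) ∋ᵐ α ∶¬ B
  thereᵐ : ∀ {Γ α β A B} → α ≢ β → Γ ∋ᵐ α ∶¬ A → (Γ ,ᵐ β ∶¬ B) ∋ᵐ α ∶¬ A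
  thereᵗ : ∀ {Γ α y A B} → Γ ∋ᵐ α ∶¬ A → (Γ ,ᵗ y ∶ B) ∋ᵐ α ∶¬ A

data _⊢_∶_ : Ctx Ty → Term → Ty → Set where
  ax   : ∀ {Γ x A} → Γ ∋ᵗ x ∶ A → Γ ⊢ var x ∶ A
  ⇒I   : ∀ {Γ x M A B} → (Γ ,ᵗ x ∶ A) ⊢ M ∶ B → Γ ⊢ lam x M ∶ (A ⇒ B)
  ⇒E   : ∀ {Γ M N A B} → Γ ⊢ M ∶ (A ⇒ B) → Γ ⊢ N ∶ A → Γ ⊢ app M (arg N) ∶ B
  ⊥I   : ∀ {Γ α M A} → Γ ∋ᵐ α ∶¬ A → Γ ⊢ M ∶ A → Γ ⊢ named α M ∶ ⊥'
  μI   : ∀ {Γ α M A} → (Γ ,ᵐ α ∶¬ A) ⊢ M ∶ ⊥' → Γ ⊢ mu α M ∶ A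
  ∧I   : ∀ {Γ M N A₁ A₂} → Γ ⊢ M ∶ A₁ → Γ ⊢ N ∶ A₂ → Γ ⊢ pair M N ∶ (A₁ ∧' A₂)
  ∧E₁  : ∀ {Γ M A₁ A₂} → Γ ⊢ M ∶ (A₁ ∧' A₂) → Γ ⊢ app M (proj Fin.zero) ∶ A₁
  ∧E₂  : ∀ {Γ M A₁ A₂} → Γ ⊢ M ∶ (A₁ ∧' A₂) → Γ ⊢ app M (proj (Fin.suc Fin.zero)) ∶ A₂
  ∨I₁  : ∀ {Γ M A₁ A₂} → Γ ⊢ M ∶ A₁ → Γ ⊢ inj Fin.zero M ∶ (A₁ ∨' A₂)
  ∨I₂  : ∀ {Γ M A₁ A₂} → Γ ⊢ M ∶ A₂ → Γ ⊢ inj (Fin.suc Fin.zero) M ∶ (A₁ ∨' A₂)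
  ∨E   : ∀ {Γ M x₁ N₁ x₂ N₂ A₁ A₂ C} → Γ ⊢ M ∶ (A₁ ∨' A₂) →
         (Γ ,ᵗ x₁ ∶ A₁) ⊢ N₁ ∶ C → (Γ ,ᵗ x₂ ∶ A₂) ⊢ N₂ ∶ C →
         Γ ⊢ app M (case x₁ N₁ x₂ N₂) ∶ C

data _⊢μ_∶_ : Ctx Tyμ → LTerm → Tyμ → Set where
  ax   : ∀ {Γ x A} → Γ ∋ᵗ x ∶ A → Γ ⊢μ var x ∶ A
  ⇒I   : ∀ {Γ x M A B} → (Γ ,ᵗ x ∶ A) ⊢μ M ∶ B → Γ ⊢μ lam x M ∶ (A ⇒ B)
  ⇒E   : ∀ {Γ M N A B} → Γ ⊢μ M ∶ (A ⇒ B) → Γ ⊢μ N ∶ A → Γ ⊢μ app M N ∶ B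
  ⊥I   : ∀ {Γ α M A} → Γ ∋ᵐ α ∶¬ A → Γ ⊢μ M ∶ A → Γ ⊢μ named α M ∶ ⊥'
  μI   : ∀ {Γ α M A} → (Γ ,ᵐ α ∶¬ A) ⊢μ M ∶ ⊥' → Γ ⊢μ mu α M ∶ A

ctx° : Ctx Ty → Ctx Tyμ
ctx° ∅ = ∅ ,ᵐ φ ∶¬ ⊥'
ctx° (Γ ,ᵗ x ∶ A) = ctx° Γ ,ᵗ x ∶ (A °)
ctx° (Γ ,ᵐ α ∶¬ B) = ctx° Γ ,ᵐ α ∶¬ (B °)

-- φ is reserved for the translation: it is not declared in Γ and does
-- not occur (free or bound) in M.

φ∉ : Ctx Ty → Set
φ∉ ∅ = ⊤
φ∉ (Γ ,ᵗ x ∶ A) = φ∉ Γ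
φ∉ (Γ ,ᵐ α ∶¬ B) = (α ≢ φ) × φ∉ Γ

data NoPhi : Term → Set
data NoPhiε : Elim → Set

data NoPhi where
  var   : ∀ {x} → NoPhi (var x)
  lam   : ∀ {x M} → NoPhi M → NoPhi (lam x M)
  app   : ∀ {M ε} → NoPhi M → NoPhiε ε → NoPhi (app M ε)
  pair  : ∀ {M N} → NoPhi M → NoPhi N → NoPhi (pair M N)
  inj   : ∀ {i M} → NoPhi M → NoPhi (inj i M)
  mu    : ∀ {α M} → α ≢ φ → NoPhi M → NoPhi (mu α M)
  named : ∀ {α M} → α ≢ φ → NoPhi M → NoPhi (named α M)

data NoPhiε where
  arg  : ∀ {N} → NoPhi N → NoPhiε (arg N)
  proj : ∀ {i} → NoPhiε (proj i)
  case : ∀ {x₁ N₁ x₂ N₂} → NoPhi N₁ → NoPhi N₂ → NoPhiε (case x₁ N₁ x₂ N₂)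

-- Induction on the typing derivation, with the target context generalised to any Δ that
-- declares φ : ¬⊥ and agrees with Γ° on every variable up to the largest one occurring in M.
-- The translation only introduces variables above those maxima, so declaring them never
-- shadows a declaration that the translation of a subterm relies on. Conjunctions and
-- disjunctions become their Church encodings; an elimination μα.(φ (M° k)) runs M° on a
-- continuation k that throws the desired component to α, and φ : ¬⊥ discards the ⊥ result.
module Submission where

open import Defs
open import Data.Nat using (ℕ; suc; _≤_; _<_; _⊔_; s≤s)
open import Data.Nat.Properties
  using (≤-refl; ≤-trans; <⇒≢; 0≢1+n; n<1+n; m<n⇒m<1+n; m≤m⊔n; m≤n⊔m; m≤n⇒m≤n⊔o; m≤n⇒m≤o⊔n)
open import Data.Product using (_,_)
open import Relation.Binary.PropositionalEquality using (_≢_; ≢-sym)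

record _⊆[_,_]_ {T : Set} (Δ : Ctx T) (n m : ℕ) (Δ′ : Ctx T) : Set where
  field
    lookupᵗ : ∀ {x A} → x ≤ n → Δ ∋ᵗ x ∶ A → Δ′ ∋ᵗ x ∶ A
    lookupᵐ : ∀ {α A} → α ≤ m → Δ ∋ᵐ α ∶¬ A → Δ′ ∋ᵐ α ∶¬ A
open _⊆[_,_]_

module _ {T : Set} {n m : ℕ} {Δ Δ′ : Ctx T} where

  ⊆-mono : ∀ {n′ m′} → n′ ≤ n → m′ ≤ m → Δ ⊆[ n , m ] Δ′ → Δ ⊆[ n′ , m′ ] Δ′
  lookupᵗ (⊆-mono n′≤n _ Δ⊆Δ′) x≤n′ = lookupᵗ Δ⊆Δ′ (≤-trans x≤n′ n′≤n)
  lookupᵐ (⊆-mono _ m′≤m Δ⊆Δ′) α≤m′ = lookupᵐ Δ⊆Δ′ (≤-trans α≤m′ m′≤m)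

  ⊆-keepᵗ : ∀ {x A} → Δ ⊆[ n , m ] Δ′ → (Δ ,ᵗ x ∶ A) ⊆[ n , m ] (Δ′ ,ᵗ x ∶ A)
  lookupᵗ (⊆-keepᵗ Δ⊆Δ′) _   here             = here
  lookupᵗ (⊆-keepᵗ Δ⊆Δ′) y≤n (thereᵗ y≢x y∈Δ) = thereᵗ y≢x (lookupᵗ Δ⊆Δ′ y≤n y∈Δ)
  lookupᵐ (⊆-keepᵗ Δ⊆Δ′) β≤m (thereᵗ β∈Δ)     = thereᵗ (lookupᵐ Δ⊆Δ′ β≤m β∈Δ)

  ⊆-keepᵐ : ∀ {α A} → Δ ⊆[ n , m ] Δ′ → (Δ ,ᵐ α ∶¬ A) ⊆[ n , m ] (Δ′ ,ᵐ α ∶¬ A)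
  lookupᵗ (⊆-keepᵐ Δ⊆Δ′) y≤n (thereᵐ y∈Δ)     = thereᵐ (lookupᵗ Δ⊆Δ′ y≤n y∈Δ)
  lookupᵐ (⊆-keepᵐ Δ⊆Δ′) _   here             = here
  lookupᵐ (⊆-keepᵐ Δ⊆Δ′) β≤m (thereᵐ β≢α β∈Δ) = thereᵐ β≢α (lookupᵐ Δ⊆Δ′ β≤m β∈Δ)

  ⊆-freshᵗ : ∀ {x A} → n < x → Δ ⊆[ n , m ] Δ′ → Δ ⊆[ n , m ] (Δ′ ,ᵗ x ∶ A)
  lookupᵗ (⊆-freshᵗ n<x Δ⊆Δ′) y≤n y∈Δ =
    thereᵗ (<⇒≢ (≤-trans (s≤s y≤n) n<x)) (lookupᵗ Δ⊆Δ′ y≤n y∈Δ)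
  lookupᵐ (⊆-freshᵗ n<x Δ⊆Δ′) β≤m β∈Δ = thereᵗ (lookupᵐ Δ⊆Δ′ β≤m β∈Δ)

  ⊆-freshᵐ : ∀ {α A} → m < α → Δ ⊆[ n , m ] Δ′ → Δ ⊆[ n , m ] (Δ′ ,ᵐ α ∶¬ A)
  lookupᵗ (⊆-freshᵐ m<α Δ⊆Δ′) y≤n y∈Δ = thereᵐ (lookupᵗ Δ⊆Δ′ y≤n y∈Δ)
  lookupᵐ (⊆-freshᵐ m<α Δ⊆Δ′) β≤m β∈Δ =
    thereᵐ (<⇒≢ (≤-trans (s≤s β≤m) m<α)) (lookupᵐ Δ⊆Δ′ β≤m β∈Δ)

⊆-⊔ˡ : ∀ {T n n′ m m′} {Δ Δ′ : Ctx T} → Δ ⊆[ n ⊔ n′ , m ⊔ m′ ] Δ′ → Δ ⊆[ n , m ] Δ′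
⊆-⊔ˡ = ⊆-mono (m≤m⊔n _ _) (m≤m⊔n _ _)

⊆-⊔ʳ : ∀ {T n n′ m m′} {Δ Δ′ : Ctx T} → Δ ⊆[ n ⊔ n′ , m ⊔ m′ ] Δ′ → Δ ⊆[ n′ , m′ ] Δ′
⊆-⊔ʳ = ⊆-mono (m≤n⊔m _ _) (m≤n⊔m _ _)

⊆-caseBranch : ∀ {T n m k x A B C} {Δ Δ′ : Ctx T} → m ≤ k → Δ ⊆[ n , m ] Δ′ →
          (Δ ,ᵗ x ∶ A) ⊆[ n , m ] (Δ′ ,ᵐ suc k ∶¬ B ,ᵗ x ∶ A ,ᵐ suc (suc k) ∶¬ C)
⊆-caseBranch m≤k Δ⊆Δ′ = ⊆-freshᵐ (m<n⇒m<1+n (s≤s m≤k)) (⊆-keepᵗ (⊆-freshᵐ (s≤s m≤k) Δ⊆Δ′))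

⊆-refl : ∀ {T n m} {Δ : Ctx T} → Δ ⊆[ n , m ] Δ
lookupᵗ ⊆-refl _ x∈Δ = x∈Δ
lookupᵐ ⊆-refl _ α∈Δ = α∈Δ

∋ᵗ-° : ∀ {Γ x A} → Γ ∋ᵗ x ∶ A → ctx° Γ ∋ᵗ x ∶ (A °)
∋ᵗ-° here              = here
∋ᵗ-° (thereᵗ x≢y x∈Γ) = thereᵗ x≢y (∋ᵗ-° x∈Γ)
∋ᵗ-° (thereᵐ x∈Γ)     = thereᵐ (∋ᵗ-° x∈Γ)

∋ᵐ-° : ∀ {Γ α A} → Γ ∋ᵐ α ∶¬ A → ctx° Γ ∋ᵐ α ∶¬ (A °)
∋ᵐ-° here              = here
∋ᵐ-° (thereᵐ α≢β α∈Γ) = thereᵐ α≢β (∋ᵐ-° α∈Γ)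
∋ᵐ-° (thereᵗ α∈Γ)     = thereᵗ (∋ᵐ-° α∈Γ)

ctx°-declares-φ : (Γ : Ctx Ty) → φ∉ Γ → ctx° Γ ∋ᵐ φ ∶¬ ⊥'
ctx°-declares-φ ∅             _            = here
ctx°-declares-φ (Γ ,ᵗ x ∶ A)  φ∉Γ          = thereᵗ (ctx°-declares-φ Γ φ∉Γ)
ctx°-declares-φ (Γ ,ᵐ α ∶¬ B) (α≢φ , φ∉Γ) = thereᵐ (≢-sym α≢φ) (ctx°-declares-φ Γ φ∉Γ)

⊢μ-catch : ∀ {Δ α P A} → Δ ∋ᵐ φ ∶¬ ⊥' → φ ≢ α →
           (Δ ,ᵐ α ∶¬ A) ⊢μ P ∶ ⊥' → Δ ⊢μ mu α (named φ P) ∶ A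
⊢μ-catch φ∈Δ φ≢α P = μI (⊥I (thereᵐ φ≢α φ∈Δ) P)

⊢μ-λthrow : ∀ {Δ x α γ N B C D} → Δ ∋ᵐ α ∶¬ C → α ≢ γ →
            (Δ ,ᵗ x ∶ B ,ᵐ γ ∶¬ D) ⊢μ N ∶ C → Δ ⊢μ lam x (mu γ (named α N)) ∶ (B ⇒ D)
⊢μ-λthrow α∈Δ α≢γ N = ⇒I (μI (⊥I (thereᵐ α≢γ (thereᵗ α∈Δ)) N))

⊢μ-projector₁ : ∀ {Δ x₁ x₂ α γ A₁ A₂} → x₁ ≢ x₂ → α ≢ γ → Δ ∋ᵐ α ∶¬ A₁ →
                Δ ⊢μ lam x₁ (lam x₂ (mu γ (named α (var x₁)))) ∶ (A₁ ⇒ A₂ ⇒ ⊥')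
⊢μ-projector₁ x₁≢x₂ α≢γ α∈Δ = ⇒I (⊢μ-λthrow (thereᵗ α∈Δ) α≢γ (ax (thereᵐ (thereᵗ x₁≢x₂ here))))

⊢μ-projector₂ : ∀ {Δ x₁ x₂ α γ A₁ A₂} → α ≢ γ → Δ ∋ᵐ α ∶¬ A₂ →
                Δ ⊢μ lam x₁ (lam x₂ (mu γ (named α (var x₂)))) ∶ (A₁ ⇒ A₂ ⇒ ⊥')
⊢μ-projector₂ α≢γ α∈Δ = ⇒I (⊢μ-λthrow (thereᵗ α∈Δ) α≢γ (ax (thereᵐ here)))

1+n≢2+n : ∀ {n} → suc n ≢ suc (suc n)
1+n≢2+n = <⇒≢ (n<1+n _)

n<2+n : ∀ {n} → n < suc (suc n)
n<2+n = m<n⇒m<1+n (n<1+n _)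

tr-preserves-⊢ : ∀ {Γ M A Δ} → NoPhi M → Γ ⊢ M ∶ A →
                 ctx° Γ ⊆[ maxV M , maxW M ] Δ → Δ ∋ᵐ φ ∶¬ ⊥' → Δ ⊢μ tr M ∶ (A °)
tr-preserves-⊢ _ (ax x∈Γ) Γ⊆Δ _ = ax (lookupᵗ Γ⊆Δ ≤-refl (∋ᵗ-° x∈Γ))
tr-preserves-⊢ (lam φ∉M) (⇒I {x = x} ⊢M) Γ⊆Δ φ∈Δ =
  ⇒I (tr-preserves-⊢ φ∉M ⊢M (⊆-keepᵗ (⊆-mono (m≤n⊔m x _) ≤-refl Γ⊆Δ)) (thereᵗ φ∈Δ))
tr-preserves-⊢ (app φ∉M (arg φ∉N)) (⇒E ⊢M ⊢N) Γ⊆Δ φ∈Δ =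
  ⇒E (tr-preserves-⊢ φ∉M ⊢M (⊆-⊔ˡ Γ⊆Δ) φ∈Δ) (tr-preserves-⊢ φ∉N ⊢N (⊆-⊔ʳ Γ⊆Δ) φ∈Δ)
tr-preserves-⊢ (named _ φ∉M) (⊥I α∈Γ ⊢M) Γ⊆Δ φ∈Δ =
  ⊥I (lookupᵐ Γ⊆Δ (m≤m⊔n _ _) (∋ᵐ-° α∈Γ))
     (tr-preserves-⊢ φ∉M ⊢M (⊆-mono ≤-refl (m≤n⊔m _ _) Γ⊆Δ) φ∈Δ)
tr-preserves-⊢ (mu α≢φ φ∉M) (μI ⊢M) Γ⊆Δ φ∈Δ =
  μI (tr-preserves-⊢ φ∉M ⊢M (⊆-keepᵐ (⊆-mono ≤-refl (m≤n⊔m _ _) Γ⊆Δ))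
                           (thereᵐ (≢-sym α≢φ) φ∈Δ))
tr-preserves-⊢ (pair φ∉M φ∉N) (∧I ⊢M ⊢N) Γ⊆Δ φ∈Δ =
  ⇒I (⇒E (⇒E (ax here)
    (tr-preserves-⊢ φ∉M ⊢M (⊆-freshᵗ (s≤s (m≤m⊔n _ _)) (⊆-⊔ˡ Γ⊆Δ)) (thereᵗ φ∈Δ)))
    (tr-preserves-⊢ φ∉N ⊢N (⊆-freshᵗ (s≤s (m≤n⊔m _ _)) (⊆-⊔ʳ Γ⊆Δ)) (thereᵗ φ∈Δ)))
tr-preserves-⊢ (app φ∉M proj) (∧E₁ ⊢M) Γ⊆Δ φ∈Δ =
  ⊢μ-catch φ∈Δ 0≢1+n
    (⇒E (tr-preserves-⊢ φ∉M ⊢M (⊆-freshᵐ (s≤s (m≤m⊔n _ _)) (⊆-⊔ˡ Γ⊆Δ)) (thereᵐ 0≢1+n φ∈Δ))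
        (⊢μ-projector₁ 1+n≢2+n 1+n≢2+n here))
tr-preserves-⊢ (app φ∉M proj) (∧E₂ ⊢M) Γ⊆Δ φ∈Δ =
  ⊢μ-catch φ∈Δ 0≢1+n
    (⇒E (tr-preserves-⊢ φ∉M ⊢M (⊆-freshᵐ (s≤s (m≤m⊔n _ _)) (⊆-⊔ˡ Γ⊆Δ)) (thereᵐ 0≢1+n φ∈Δ))
        (⊢μ-projector₂ 1+n≢2+n here))
tr-preserves-⊢ (inj φ∉M) (∨I₁ ⊢M) Γ⊆Δ φ∈Δ =
  ⇒I (⇒I (⇒E (ax (thereᵗ 1+n≢2+n here))
    (tr-preserves-⊢ φ∉M ⊢M (⊆-freshᵗ n<2+n (⊆-freshᵗ (n<1+n _) Γ⊆Δ)) (thereᵗ (thereᵗ φ∈Δ)))))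
tr-preserves-⊢ (inj φ∉M) (∨I₂ ⊢M) Γ⊆Δ φ∈Δ =
  ⇒I (⇒I (⇒E (ax here)
    (tr-preserves-⊢ φ∉M ⊢M (⊆-freshᵗ n<2+n (⊆-freshᵗ (n<1+n _) Γ⊆Δ)) (thereᵗ (thereᵗ φ∈Δ)))))
tr-preserves-⊢ (app φ∉M (case φ∉N₁ φ∉N₂))
               (∨E {M = M} {x₁ = x₁} {N₁ = N₁} {x₂ = x₂} {N₂ = N₂} ⊢M ⊢N₁ ⊢N₂) Γ⊆Δ φ∈Δ =
  ⊢μ-catch φ∈Δ 0≢1+n (⇒E (⇒E
    (tr-preserves-⊢ φ∉M ⊢M (⊆-freshᵐ (s≤s (m≤m⊔n _ _)) (⊆-⊔ˡ Γ⊆Δ)) (thereᵐ 0≢1+n φ∈Δ))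
    (⊢μ-λthrow here 1+n≢2+n
      (tr-preserves-⊢ φ∉N₁ ⊢N₁ (⊆-caseBranch W₁ (⊆-mono V₁ W₁ Γ⊆Δ))
                              (thereᵐ 0≢1+n (thereᵗ (thereᵐ 0≢1+n φ∈Δ))))))
    (⊢μ-λthrow here 1+n≢2+n
      (tr-preserves-⊢ φ∉N₂ ⊢N₂ (⊆-caseBranch W₂ (⊆-mono V₂ W₂ Γ⊆Δ))
                              (thereᵐ 0≢1+n (thereᵗ (thereᵐ 0≢1+n φ∈Δ))))))
  where
    W₁ : maxW N₁ ≤ maxW M ⊔ (maxW N₁ ⊔ maxW N₂)
    W₁ = m≤n⇒m≤o⊔n (maxW M) (m≤m⊔n (maxW N₁) (maxW N₂))
    W₂ : maxW N₂ ≤ maxW M ⊔ (maxW N₁ ⊔ maxW N₂)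
    W₂ = m≤n⇒m≤o⊔n (maxW M) (m≤n⊔m (maxW N₁) (maxW N₂))
    V₁ : maxV N₁ ≤ maxV M ⊔ (x₁ ⊔ maxV N₁ ⊔ x₂ ⊔ maxV N₂)
    V₁ = m≤n⇒m≤o⊔n (maxV M) (m≤n⇒m≤n⊔o (maxV N₂) (m≤n⇒m≤n⊔o x₂ (m≤n⊔m x₁ (maxV N₁))))
    V₂ : maxV N₂ ≤ maxV M ⊔ (x₁ ⊔ maxV N₁ ⊔ x₂ ⊔ maxV N₂)
    V₂ = m≤n⇒m≤o⊔n (maxV M) (m≤n⊔m (x₁ ⊔ maxV N₁ ⊔ x₂) (maxV N₂))

lemma6p5 : (Γ : Ctx Ty) (M : Term) (A : Ty) → φ∉ Γ → NoPhi M →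
    Γ ⊢ M ∶ A → ctx° Γ ⊢μ tr M ∶ (A °)
lemma6p5 Γ M A φ∉Γ φ∉M ⊢M = tr-preserves-⊢ φ∉M ⊢M ⊆-refl (ctx°-declares-φ Γ φ∉Γ)
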